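{- Let $n\geq 1$ and consider any coloring of the edges of the complete graph $K_n$ with $3$ colors such that no triangle has its three edges colored with three distinct colors. Then there is a set $S$ of at most two colors such that the graph $G_S$ on the vertex set of $K_n$, consisting of exactly the edges whose color lies in $S$, has chromatic number at least $n^{2/3}$.
   Context: A triangle whose three edges have three distinct colors is called a rainbow triangle; an edge-coloring of a complete graph with no rainbow triangle is called a Gallai coloring. -}

module Defs where

open import Data.Nat using (ℕ; _≤_; _^_)
open import Data.Fin using (Fin)
open import Data.Fin.Subset using (Subset; _∈_)
open import Data.Product using (Σ; _×_; ∃-syntax)
open import Relation.Nullary using (¬_)
open import Relation.Binary.PropositionalEquality using (_≡_; _≢_)

-- An edge-colouring of K_n with colours from Fin r: a function on ordered
-- pairs of vertices, required to be symmetric; values on the diagonal are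
-- irrelevant (loops are not edges of K_n).
EdgeColouring : ℕ → ℕ → Set
EdgeColouring n r = Fin n → Fin n → Fin r

Symmetric : ∀ {n r} → EdgeColouring n r → Set
Symmetric {n} c = (i j : Fin n) → c i j ≡ c j i

RainbowTriangle : ∀ {n r} → EdgeColouring n r → Fin n → Fin n → Fin n → Set
RainbowTriangle c i j k =
  (i ≢ j × j ≢ k × i ≢ k) ×
  (c i j ≢ c j k × c j k ≢ c i k × c i j ≢ c i k)

Gallai : ∀ {n r} → EdgeColouring n r → Set
Gallai {n} c = (i j k : Fin n) → ¬ RainbowTriangle c i j k

Adj : ∀ {n r} → EdgeColouring n r → Subset r → Fin n → Fin n → Set
Adj c S i j = (i ≢ j) × (c i j ∈ S)

ProperColouring : ∀ {n r} → EdgeColouring n r → Subset r → (k : ℕ) → (Fin n → Fin k) → Set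
ProperColouring {n} c S k f = (i j : Fin n) → Adj c S i j → f i ≢ f j

Colourable : ∀ {n r} → EdgeColouring n r → Subset r → ℕ → Set
Colourable {n} c S k = ∃[ f ] ProperColouring c S k f

-- χ(G_S)^3 ≥ m, i.e. χ(G_S) ≥ m^{1/3}: every proper colouring of G_S
-- with k colours has k^3 ≥ m.
ChromaticCubeAtLeast : ∀ {n r} → EdgeColouring n r → Subset r → ℕ → Set
ChromaticCubeAtLeast {n} c S m = (k : ℕ) → Colourable c S k → m ≤ k ^ 3

-- For each colour i, a proper colouring with k i colours of the graph of the other two
-- colours partitions the vertices into k i cliques of colour i; we show n² ≤ k₀ k₁ k₂, so
-- some k i is at least n^(2/3). By Gallai's splitting lemma, on every vertex set U with at
-- least two vertices some colour r has a disconnected graph. The r-cliques lie inside the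
-- r-components of U, so their numbers add up over the components. A vertex with no r-edge
-- into an r-connected set sees all of it in one colour; hence for cliques P of colour p and
-- Q of colour q (the other two colours) at most one component meets both, and the products
-- k_p k_q over the components add up to at most k_p k_q over U. Induction over the
-- components and Cauchy–Schwarz then give ∣ U ∣² ≤ k_p k_q k_r, counted on U.

module Submission where

open import Defs
open import Data.Bool.Base using (true; false; if_then_else_)
open import Data.Fin using (Fin; zero; suc; #_)
open import Data.Fin.Properties using (_≟_; any?; all?)
open import Data.Fin.Subset
  using (Subset; _∈_; _∉_; _⊆_; _⊂_; _⊃_; ⁅_⁆; _∪_; _─_; _-_; ∁; ⊥; ⊤; ∣_∣; Nonempty; Empty;
         inside; outside)
open import Data.Fin.Subset.Properties
open import Data.Fin.Subset.Induction using (⊂-wellFounded; ⊃-wellFounded)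
open import Data.Nat.Base using (ℕ; zero; suc; _+_; _*_; _^_; _∸_; _≤_; _<_; z≤n; s≤s; s≤s⁻¹)
open import Data.Nat.Properties
  using (≤-reflexive; ≤-trans; ≤-total; ≤-antisym; ≮⇒≥; <⇒≱; ≰⇒>; _≤?_; _<?_; +-suc; +-comm;
         *-comm; *-identityʳ; +-mono-≤; +-monoʳ-≤; *-mono-≤; *-monoˡ-≤; *-monoʳ-≤; *-mono-<;
         ^-monoˡ-≤; m≤m+n; m≤n*m; m≤n⇒∃[o]m+o≡n; anyUpTo?; +-0-commutativeMonoid; module ≤-Reasoning)
open import Algebra.Properties.CommutativeMonoid.Sum +-0-commutativeMonoid using (sum; ∑-distrib-+)
open import Data.Nat.Tactic.RingSolver using (solve-∀)
open import Data.Product using (∃; ∃-syntax; _×_; _,_; proj₁; proj₂)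
open import Data.Sum.Base using (_⊎_; inj₁; inj₂)
open import Data.Vec.Base using ([]; _∷_; here; there; lookup; tabulate)
open import Data.Vec.Properties using (lookup∘tabulate; lookup⇒[]=; []=⇒lookup)
open import Data.Vec.Functional as Vector using (head; tail)
open import Function.Base using (_∘_; id)
open import Induction.WellFounded using (Acc; acc)
open import Relation.Binary.PropositionalEquality
  using (_≡_; _≢_; _≗_; refl; sym; trans; cong; cong₂; subst; subst₂; module ≡-Reasoning)
open import Relation.Nullary using (¬_; Dec; yes; no; does; contradiction)
open import Relation.Nullary.Decidable
  using (_×-dec_; _→-dec_; ¬?; dec-true; dec-false; decidable-stable)
open import Relation.Unary using (Decidable)

square-≤-cancel : ∀ {a b} → a * a ≤ b * b → a ≤ b
square-≤-cancel a²≤b² = ≮⇒≥ λ b<a → <⇒≱ (*-mono-< b<a b<a) a²≤b²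

private
  four-mul≤square-≥ : ∀ {x y} → y ≤ x → 4 * (x * y) ≤ (x + y) * (x + y)
  four-mul≤square-≥ {y = y} y≤x with m≤n⇒∃[o]m+o≡n y≤x
  ... | d , refl = subst (4 * ((y + d) * y) ≤_) (expand y d) (m≤m+n _ (d * d))
    where
    expand : ∀ y d → 4 * ((y + d) * y) + d * d ≡ (y + d + y) * (y + d + y)
    expand = solve-∀

four-mul≤square : ∀ x y → 4 * (x * y) ≤ (x + y) * (x + y)
four-mul≤square x y with ≤-total y x
... | inj₁ y≤x = four-mul≤square-≥ y≤x
... | inj₂ x≤y = subst₂ _≤_ (cong (4 *_) (*-comm y x)) (cong₂ _*_ (+-comm y x) (+-comm y x))
                   (four-mul≤square-≥ x≤y)

cauchy-schwarz₂ : ∀ {s t x y u v} → s * s ≤ x * u → t * t ≤ y * v →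
                  (s + t) * (s + t) ≤ (x + y) * (u + v)
cauchy-schwarz₂ {s} {t} {x} {y} {u} {v} s²≤xu t²≤yv = begin
  (s + t) * (s + t)               ≡⟨ square-+ s t ⟩
  s * s + t * t + 2 * (s * t)     ≤⟨ +-mono-≤ (+-mono-≤ s²≤xu t²≤yv) cross ⟩
  x * u + y * v + (x * v + y * u) ≡⟨ product-+ x y u v ⟩
  (x + y) * (u + v)               ∎
  where
  open ≤-Reasoning
  square-+ : ∀ s t → (s + t) * (s + t) ≡ s * s + t * t + 2 * (s * t)
  square-+ = solve-∀
  product-+ : ∀ x y u v → x * u + y * v + (x * v + y * u) ≡ (x + y) * (u + v)
  product-+ = solve-∀
  regroup₁ : ∀ s t → (2 * (s * t)) * (2 * (s * t)) ≡ 4 * ((s * s) * (t * t))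
  regroup₁ = solve-∀
  regroup₂ : ∀ x y u v → (x * u) * (y * v) ≡ (x * v) * (y * u)
  regroup₂ = solve-∀
  cross : 2 * (s * t) ≤ x * v + y * u
  cross = square-≤-cancel (begin
    (2 * (s * t)) * (2 * (s * t)) ≡⟨ regroup₁ s t ⟩
    4 * ((s * s) * (t * t))       ≤⟨ *-monoʳ-≤ 4 (*-mono-≤ s²≤xu t²≤yv) ⟩
    4 * ((x * u) * (y * v))       ≡⟨ cong (4 *_) (regroup₂ x y u v) ⟩
    4 * ((x * v) * (y * u))       ≤⟨ four-mul≤square (x * v) (y * u) ⟩
    (x * v + y * u) * (x * v + y * u) ∎)

square≤cube : ∀ {m k} → 1 ≤ m → m ≤ k → m ^ 2 ≤ k ^ 3
square≤cube {k = zero}  1≤m m≤0 = contradiction (≤-trans 1≤m m≤0) λ ()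
square≤cube {k = suc k} _   m≤k = ≤-trans (^-monoˡ-≤ 2 m≤k) (m≤n*m (suc k ^ 2) (suc k))

sum-mono-≤ : ∀ {m} {f g : Fin m → ℕ} → (∀ i → f i ≤ g i) → sum f ≤ sum g
sum-mono-≤ {zero}  _   = z≤n
sum-mono-≤ {suc m} f≤g = +-mono-≤ (f≤g zero) (sum-mono-≤ (f≤g ∘ suc))

small-cubes⇒product< : ∀ {a b c m} → a ^ 3 < m → b ^ 3 < m → c ^ 3 < m → a * b * c < m
small-cubes⇒product< {a} {b} {c} {m} a³<m b³<m c³<m = ≰⇒> λ m≤abc → <⇒≱ (begin-strict
  (a * b * c) ^ 3     ≡⟨ cube-* a b c ⟩
  a ^ 3 * b ^ 3 * c ^ 3 <⟨ *-mono-< (*-mono-< a³<m b³<m) c³<m ⟩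
  m * m * m           ≡⟨ cube m ⟨
  m ^ 3               ∎) (^-monoˡ-≤ 3 m≤abc)
  where
  open ≤-Reasoning
  cube-* : ∀ a b c → let x = a * b * c in
           x * (x * (x * 1)) ≡ (a * (a * (a * 1))) * (b * (b * (b * 1))) * (c * (c * (c * 1)))
  cube-* = solve-∀
  cube : ∀ m → m * (m * (m * 1)) ≡ m * m * m
  cube = solve-∀

x∈p─q⇒x∉q : ∀ {n x} {p q : Subset n} → x ∈ p ─ q → x ∉ q
x∈p─q⇒x∉q {p = _ ∷ _} {outside ∷ _} here        ()
x∈p─q⇒x∉q {p = _ ∷ _} {outside ∷ _} (there x∈) (there x∈q) = x∈p─q⇒x∉q x∈ x∈q
x∈p─q⇒x∉q {p = _ ∷ _} {inside  ∷ _} (there x∈) (there x∈q) = x∈p─q⇒x∉q x∈ x∈q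

∣p∣≡∣q∣+∣p─q∣ : ∀ {n} (p q : Subset n) → q ⊆ p → ∣ p ∣ ≡ ∣ q ∣ + ∣ p ─ q ∣
∣p∣≡∣q∣+∣p─q∣ []            []            _   = refl
∣p∣≡∣q∣+∣p─q∣ (outside ∷ p) (outside ∷ q) q⊆p = ∣p∣≡∣q∣+∣p─q∣ p q (drop-∷-⊆ q⊆p)
∣p∣≡∣q∣+∣p─q∣ (inside  ∷ p) (outside ∷ q) q⊆p =
  trans (cong suc (∣p∣≡∣q∣+∣p─q∣ p q (drop-∷-⊆ q⊆p))) (sym (+-suc _ _))
∣p∣≡∣q∣+∣p─q∣ (inside  ∷ p) (inside  ∷ q) q⊆p = cong suc (∣p∣≡∣q∣+∣p─q∣ p q (drop-∷-⊆ q⊆p))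
∣p∣≡∣q∣+∣p─q∣ (outside ∷ p) (inside  ∷ q) q⊆p = contradiction (q⊆p here) λ ()

module _ {n : ℕ} where

  ⁅⁆⊆ : ∀ {x} {p : Subset n} → x ∈ p → ⁅ x ⁆ ⊆ p
  ⁅⁆⊆ {x} x∈p y∈⁅x⁆ = subst (_∈ _) (sym (x∈⁅y⁆⇒x≡y x y∈⁅x⁆)) x∈p

  empty⇒∣p∣≡0 : ∀ {p : Subset n} → Empty p → ∣ p ∣ ≡ 0
  empty⇒∣p∣≡0 {p} p-empty = trans (cong ∣_∣ (Empty-unique p-empty)) (∣⊥∣≡0 n)

  x∈p⇒0<∣p∣ : ∀ {x} {p : Subset n} → x ∈ p → 0 < ∣ p ∣
  x∈p⇒0<∣p∣ {x} x∈p = subst (_≤ _) (∣⁅x⁆∣≡1 x) (p⊆q⇒∣p∣≤∣q∣ (⁅⁆⊆ x∈p))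

  0<∣p∣⇒nonempty : ∀ {p : Subset n} → 0 < ∣ p ∣ → Nonempty p
  0<∣p∣⇒nonempty {p} 0<∣p∣ with nonempty? p
  ... | yes p-nonempty = p-nonempty
  ... | no p-empty = contradiction (empty⇒∣p∣≡0 p-empty) λ ∣p∣≡0 → <⇒≱ 0<∣p∣ (≤-reflexive ∣p∣≡0)

  ∣p∣≡1+∣p-x∣ : ∀ {x} {p : Subset n} → x ∈ p → ∣ p ∣ ≡ suc ∣ p - x ∣
  ∣p∣≡1+∣p-x∣ {x} {p} x∈p = trans (∣p∣≡∣q∣+∣p─q∣ p ⁅ x ⁆ (⁅⁆⊆ x∈p)) (cong (_+ ∣ p - x ∣) (∣⁅x⁆∣≡1 x))

  two-elements⇒2≤∣p∣ : ∀ {x y} {p : Subset n} → x ∈ p → y ∈ p → x ≢ y → 2 ≤ ∣ p ∣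
  two-elements⇒2≤∣p∣ x∈p y∈p x≢y = subst (2 ≤_) (sym (∣p∣≡1+∣p-x∣ x∈p))
    (s≤s (x∈p⇒0<∣p∣ (x∈p∧x≢y⇒x∈p-y y∈p (x≢y ∘ sym))))

  disjoint⇒∣p∣+∣q∣≤∣s∣ : ∀ {p q s : Subset n} → p ⊆ s → q ⊆ s → (∀ {x} → x ∈ p → x ∉ q) →
                         ∣ p ∣ + ∣ q ∣ ≤ ∣ s ∣
  disjoint⇒∣p∣+∣q∣≤∣s∣ {p} {q} {s} p⊆s q⊆s disjoint =
    subst (∣ p ∣ + ∣ q ∣ ≤_) (sym (∣p∣≡∣q∣+∣p─q∣ s p p⊆s))
      (+-monoʳ-≤ ∣ p ∣ (p⊆q⇒∣p∣≤∣q∣ λ x∈q → x∈p∧x∉q⇒x∈p─q (q⊆s x∈q) λ x∈p → disjoint x∈p x∈q))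

  toSubset : ∀ {P : Fin n → Set} → Decidable P → Subset n
  toSubset P? = tabulate (does ∘ P?)

  ∈-toSubset⁺ : ∀ {P : Fin n → Set} (P? : Decidable P) {x} → P x → x ∈ toSubset P?
  ∈-toSubset⁺ P? {x} px = lookup⇒[]= x _ (trans (lookup∘tabulate _ x) (dec-true (P? x) px))

  ∈-toSubset⁻ : ∀ {P : Fin n → Set} (P? : Decidable P) {x} → x ∈ toSubset P? → P x
  ∈-toSubset⁻ P? {x} x∈ = decidable-stable (P? x) λ ¬px →
    contradiction (trans (sym ([]=⇒lookup x∈)) (trans (lookup∘tabulate _ x) (dec-false (P? x) ¬px))) λ ()

hits? : ∀ {m n} (g : Fin m → Fin n) (U : Subset m) → Decidable λ α → ∃[ x ] (x ∈ U × g x ≡ α)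
hits? g U α = any? λ x → x ∈? U ×-dec g x ≟ α

image : ∀ {m n} → (Fin m → Fin n) → Subset m → Subset n
image g U = toSubset (hits? g U)

module _ {m n} {g : Fin m → Fin n} {U : Subset m} where

  ∈-image⁺ : ∀ {x} → x ∈ U → g x ∈ image g U
  ∈-image⁺ {x} x∈U = ∈-toSubset⁺ (hits? g U) (x , x∈U , refl)

  ∈-image⁻ : ∀ {α} → α ∈ image g U → ∃[ x ] (x ∈ U × g x ≡ α)
  ∈-image⁻ = ∈-toSubset⁻ (hits? g U)

image-mono : ∀ {m n} {g : Fin m → Fin n} {U V : Subset m} → U ⊆ V → image g U ⊆ image g V
image-mono {g = g} U⊆V α∈ with ∈-image⁻ {g = g} α∈
... | x , x∈U , refl = ∈-image⁺ (U⊆V x∈U)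

-- subsets of Fin a × Fin b, given by their fibres over Fin a
Subset₂ : ℕ → ℕ → Set
Subset₂ a b = Fin a → Subset b

module _ {a b : ℕ} where

  ∣_∣₂ : Subset₂ a b → ℕ
  ∣ P ∣₂ = sum λ α → ∣ P α ∣

  _⊆₂_ : Subset₂ a b → Subset₂ a b → Set
  P ⊆₂ Q = ∀ α → P α ⊆ Q α

  _∪₂_ : Subset₂ a b → Subset₂ a b → Subset₂ a b
  (P ∪₂ Q) α = P α ∪ Q α

  _⊠_ : Subset a → Subset b → Subset₂ a b
  (A ⊠ B) α = if lookup A α then B else ⊥

  ∣∣₂-mono : ∀ {P Q : Subset₂ a b} → P ⊆₂ Q → ∣ P ∣₂ ≤ ∣ Q ∣₂
  ∣∣₂-mono P⊆Q = sum-mono-≤ λ α → p⊆q⇒∣p∣≤∣q∣ (P⊆Q α)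

  ∣∪₂∣-disjoint : ∀ {P Q : Subset₂ a b} → (∀ {α β} → β ∈ P α → β ∉ Q α) → ∣ P ∣₂ + ∣ Q ∣₂ ≤ ∣ P ∪₂ Q ∣₂
  ∣∪₂∣-disjoint {P} {Q} disjoint = subst (_≤ ∣ P ∪₂ Q ∣₂) (∑-distrib-+ (λ α → ∣ P α ∣) (λ α → ∣ Q α ∣))
    (sum-mono-≤ λ α → disjoint⇒∣p∣+∣q∣≤∣s∣ (p⊆p∪q (Q α)) (q⊆p∪q (P α) (Q α)) disjoint)

  ∈-⊠⁺ : ∀ {A B α β} → α ∈ A → β ∈ B → β ∈ (A ⊠ B) α
  ∈-⊠⁺ {A} {α = α} α∈A β∈B rewrite []=⇒lookup α∈A = β∈B

  ∈-⊠⁻ : ∀ {A B α β} → β ∈ (A ⊠ B) α → α ∈ A × β ∈ B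
  ∈-⊠⁻ {A} {α = α} β∈ with lookup A α in eq
  ... | true  = lookup⇒[]= α A eq , β∈
  ... | false = contradiction β∈ ∉⊥

∣⊠∣₂ : ∀ {a b} (A : Subset a) (B : Subset b) → ∣ A ⊠ B ∣₂ ≡ ∣ A ∣ * ∣ B ∣
∣⊠∣₂ []            B = refl
∣⊠∣₂ (inside  ∷ A) B = cong (∣ B ∣ +_) (∣⊠∣₂ A B)
∣⊠∣₂ {b = b} (outside ∷ A) B = trans (cong (_+ ∣ A ⊠ B ∣₂) (∣⊥∣≡0 b)) (∣⊠∣₂ A B)

-- Monochromatic connectivity

module _ {n k} (c : EdgeColouring n k) where

  Closed : Fin k → Subset n → Subset n → Set
  Closed r U C = ∀ {a b} → a ∈ C → b ∈ U → c a b ≡ r → b ∈ C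

  -- connectedness of the r-coloured graph on K, as an induction principle along its edges
  Connected : Fin k → Subset n → Set₁
  Connected r K = (P : Fin n → Set) → (∀ {a b} → a ∈ K → b ∈ K → c a b ≡ r → P a → P b) →
                  ∀ {x y} → x ∈ K → P x → y ∈ K → P y

  ⁅⁆-connected : ∀ {r} x → Connected r ⁅ x ⁆
  ⁅⁆-connected x P _ {y} {z} y∈⁅x⁆ Py z∈⁅x⁆ =
    subst P (trans (x∈⁅y⁆⇒x≡y x y∈⁅x⁆) (sym (x∈⁅y⁆⇒x≡y x z∈⁅x⁆))) Py

  connected⊆closed : ∀ {r K U C x} → Connected r K → K ⊆ U → Closed r U C → x ∈ K → x ∈ C → K ⊆ C
  connected⊆closed conn K⊆U C-closed x∈K x∈C =
    conn (_∈ _) (λ _ b∈K ab≡r a∈C → C-closed a∈C (K⊆U b∈K) ab≡r) x∈K x∈C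

module _ {n k} {c : EdgeColouring n k} (c-sym : Symmetric c) where

  connected-∪⁅⁆ : ∀ {r K a b} → Connected c r K → a ∈ K → c a b ≡ r → Connected c r (K ∪ ⁅ b ⁆)
  connected-∪⁅⁆ {r} {K} {a} {b} K-conn a∈K ab≡r P step {x} x∈ Px = reach
    where
    ↑ : K ⊆ K ∪ ⁅ b ⁆
    ↑ = p⊆p∪q ⁅ b ⁆
    b∈ : b ∈ K ∪ ⁅ b ⁆
    b∈ = q⊆p∪q K ⁅ b ⁆ (x∈⁅x⁆ b)
    Pa : P a
    Pa with x∈p∪q⁻ K ⁅ b ⁆ x∈
    ... | inj₁ x∈K   = K-conn P (λ u∈ v∈ → step (↑ u∈) (↑ v∈)) x∈K Px a∈K
    ... | inj₂ x∈⁅b⁆ = step b∈ (↑ a∈K) (trans (c-sym b a) ab≡r) (subst P (x∈⁅y⁆⇒x≡y b x∈⁅b⁆) Px)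
    reach : ∀ {y} → y ∈ K ∪ ⁅ b ⁆ → P y
    reach y∈ with x∈p∪q⁻ K ⁅ b ⁆ y∈
    ... | inj₁ y∈K   = K-conn P (λ u∈ v∈ → step (↑ u∈) (↑ v∈)) a∈K Pa y∈K
    ... | inj₂ y∈⁅b⁆ = subst P (sym (x∈⁅y⁆⇒x≡y b y∈⁅b⁆)) (step (↑ a∈K) b∈ ab≡r Pa)

  record Closure (r : Fin k) (U S : Subset n) : Set₁ where
    field
      set       : Subset n
      ⊇S        : S ⊆ set
      ⊆S∪U      : ∀ {z} → z ∈ set → z ∈ S ⊎ z ∈ U
      closed    : Closed c r U set
      connected : Connected c r S → Connected c r set

  closure : ∀ r U S → Acc _⊃_ S → Closure r U S
  closure r U S (acc rec)
    with any? (λ a → any? λ b → a ∈? S ×-dec b ∈? U ×-dec c a b ≟ r ×-dec ¬? (b ∈? S))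
  ... | no no-exit = record
    { set = S ; ⊇S = id ; ⊆S∪U = inj₁ ; closed = S-closed ; connected = id }
    where
    S-closed : Closed c r U S
    S-closed {a} {b} a∈S b∈U ab≡r with b ∈? S
    ... | yes b∈S = b∈S
    ... | no  b∉S = contradiction (a , b , a∈S , b∈U , ab≡r , b∉S) no-exit
  ... | yes (a , b , a∈S , b∈U , ab≡r , b∉S) = record
    { set       = set
    ; ⊇S        = ⊇S ∘ p⊆p∪q ⁅ b ⁆
    ; ⊆S∪U      = ⊆S∪U′
    ; closed    = closed
    ; connected = λ S-conn → connected (connected-∪⁅⁆ S-conn a∈S ab≡r)
    }
    where
    S⊂S∪b : S ⊂ S ∪ ⁅ b ⁆
    S⊂S∪b = p⊆p∪q ⁅ b ⁆ , b , q⊆p∪q S ⁅ b ⁆ (x∈⁅x⁆ b) , b∉S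
    open Closure (closure r U (S ∪ ⁅ b ⁆) (rec S⊂S∪b))
    ⊆S∪U′ : ∀ {z} → z ∈ set → z ∈ S ⊎ z ∈ U
    ⊆S∪U′ z∈ with ⊆S∪U z∈
    ... | inj₂ z∈U = inj₂ z∈U
    ... | inj₁ z∈S∪b with x∈p∪q⁻ S ⁅ b ⁆ z∈S∪b
    ...   | inj₁ z∈S   = inj₁ z∈S
    ...   | inj₂ z∈⁅b⁆ = inj₂ (subst (_∈ U) (sym (x∈⁅y⁆⇒x≡y b z∈⁅b⁆)) b∈U)

  private
    closure-of : ∀ r U x → Closure r U ⁅ x ⁆
    closure-of r U x = closure r U ⁅ x ⁆ (⊃-wellFounded _)

  component : Fin k → Subset n → Fin n → Subset n
  component r U x = Closure.set (closure-of r U x)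

  module _ {r : Fin k} {U : Subset n} {x : Fin n} where

    x∈component : x ∈ component r U x
    x∈component = Closure.⊇S (closure-of r U x) (x∈⁅x⁆ x)

    component⊆ : x ∈ U → component r U x ⊆ U
    component⊆ x∈U z∈ with Closure.⊆S∪U (closure-of r U x) z∈
    ... | inj₁ z∈⁅x⁆ = subst (_∈ U) (sym (x∈⁅y⁆⇒x≡y x z∈⁅x⁆)) x∈U
    ... | inj₂ z∈U   = z∈U

    component-closed : Closed c r U (component r U x)
    component-closed = Closure.closed (closure-of r U x)

    component-connected : Connected c r (component r U x)
    component-connected = Closure.connected (closure-of r U x) (⁅⁆-connected c x)

module _ {n k} {c : EdgeColouring n k} (gallai : Gallai c) where

  no-rainbow : ∀ {x y z} → x ≢ y → y ≢ z → x ≢ z → c x y ≢ c y z → c y z ≢ c x z → c x y ≡ c x z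
  no-rainbow x≢y y≢z x≢z e₁ e₂ =
    decidable-stable (_ ≟ _) λ e₃ → gallai _ _ _ ((x≢y , y≢z , x≢z) , e₁ , e₂ , e₃)

  -- Along an r-edge uv of K the colour seen from y cannot change, or y u v would be rainbow.
  uniform-towards-connected : ∀ {r K y a b} → Connected c r K → y ∉ K → (∀ {z} → z ∈ K → c y z ≢ r) →
                              a ∈ K → b ∈ K → c y a ≡ c y b
  uniform-towards-connected {r} {K} {y} {a} K-conn y∉K no-r-edge a∈K =
    K-conn (λ z → c y a ≡ c y z) step a∈K refl
    where
    step : ∀ {u v} → u ∈ K → v ∈ K → c u v ≡ r → c y a ≡ c y u → c y a ≡ c y v
    step {u} {v} u∈K v∈K uv≡r ya≡yu with u ≟ v
    ... | yes refl = ya≡yu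
    ... | no  u≢v  = trans ya≡yu (no-rainbow (λ { refl → y∉K u∈K }) u≢v (λ { refl → y∉K v∈K })
                       (λ yu≡uv → no-r-edge u∈K (trans yu≡uv uv≡r))
                       (λ uv≡yv → no-r-edge v∈K (trans (sym uv≡yv) uv≡r)))

rot : Fin 3 → Fin 3
rot zero             = suc zero
rot (suc zero)       = suc (suc zero)
rot (suc (suc zero)) = zero

rot≢id : ∀ r → rot r ≢ r
rot≢id zero ()
rot≢id (suc zero) ()
rot≢id (suc (suc zero)) ()

rot²≢id : ∀ r → rot (rot r) ≢ r
rot²≢id zero ()
rot²≢id (suc zero) ()
rot²≢id (suc (suc zero)) ()

rot≢rot² : ∀ r → rot r ≢ rot (rot r)
rot≢rot² zero ()
rot≢rot² (suc zero) ()
rot≢rot² (suc (suc zero)) ()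

≢⇒rot⊎rot² : ∀ {r s} → s ≢ r → s ≡ rot r ⊎ s ≡ rot (rot r)
≢⇒rot⊎rot² {zero}             {zero}             s≢r = contradiction refl s≢r
≢⇒rot⊎rot² {zero}             {suc zero}         _   = inj₁ refl
≢⇒rot⊎rot² {zero}             {suc (suc zero)}   _   = inj₂ refl
≢⇒rot⊎rot² {suc zero}         {zero}             _   = inj₂ refl
≢⇒rot⊎rot² {suc zero}         {suc zero}         s≢r = contradiction refl s≢r
≢⇒rot⊎rot² {suc zero}         {suc (suc zero)}   _   = inj₁ refl
≢⇒rot⊎rot² {suc (suc zero)}   {zero}             _   = inj₁ refl
≢⇒rot⊎rot² {suc (suc zero)}   {suc zero}         _   = inj₂ refl
≢⇒rot⊎rot² {suc (suc zero)}   {suc (suc zero)}   s≢r = contradiction refl s≢r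

third-colour₁ : ∀ {r s} → s ≢ r → s ≢ rot (rot r) → s ≡ rot r
third-colour₁ s≢r s≢rot² with ≢⇒rot⊎rot² s≢r
... | inj₁ s≡rot  = s≡rot
... | inj₂ s≡rot² = contradiction s≡rot² s≢rot²

third-colour₂ : ∀ {r s} → s ≢ r → s ≢ rot r → s ≡ rot (rot r)
third-colour₂ s≢r s≢rot with ≢⇒rot⊎rot² s≢r
... | inj₁ s≡rot  = contradiction s≡rot s≢rot
... | inj₂ s≡rot² = s≡rot²

rotate-product : ∀ (g : Fin 3 → ℕ) r → g (rot r) * g (rot (rot r)) * g r ≡ g (# 0) * g (# 1) * g (# 2)
rotate-product g zero             = cycle (g (# 0)) (g (# 1)) (g (# 2))
  where cycle : ∀ x y z → y * z * x ≡ x * y * z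
        cycle = solve-∀
rotate-product g (suc zero)       = cycle (g (# 0)) (g (# 1)) (g (# 2))
  where cycle : ∀ x y z → z * x * y ≡ x * y * z
        cycle = solve-∀
rotate-product g (suc (suc zero)) = refl

-- Gallai's splitting lemma for three colours

module _ {n} {c : EdgeColouring n 3} (c-sym : Symmetric c) (gallai : Gallai c) where

  -- the graph of colour `colour` on U is disconnected, `part` being a union of components
  record Split (U : Subset n) : Set where
    field
      colour : Fin 3
      part   : Subset n
      closed : Closed c colour U part
      inner  : ∃[ x ] (x ∈ U × x ∈ part)
      outer  : ∃[ y ] (y ∈ U × y ∉ part)

  connected⊂ : ∀ {U V} (sep : Split U) → Connected c (Split.colour sep) V → V ⊆ U → V ⊂ U
  connected⊂ {V = V} sep V-conn V⊆U with Split.inner sep | Split.outer sep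
  ... | x , x∈U , x∈part | y , y∈U , y∉part with x ∈? V
  ...   | no  x∉V = V⊆U , x , x∈U , x∉V
  ...   | yes x∈V = V⊆U , y , y∈U ,
          λ y∈V → y∉part (connected⊆closed c V-conn V⊆U (Split.closed sep) x∈V x∈part y∈V)

  split-pair : ∀ {U v w} → v ∈ U → w ∈ U → v ≢ w → (∀ {b} → b ∈ U → b ≢ v → b ≡ w) → Split U
  split-pair {U} {v} {w} v∈U w∈U v≢w only-w = record
    { colour = rot (c v w)
    ; part   = ⁅ v ⁆
    ; closed = v-closed
    ; inner  = v , v∈U , x∈⁅x⁆ v
    ; outer  = w , w∈U , λ w∈⁅v⁆ → v≢w (sym (x∈⁅y⁆⇒x≡y v w∈⁅v⁆))
    }
    where
    v-closed : Closed c (rot (c v w)) U ⁅ v ⁆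
    v-closed {a} {b} a∈⁅v⁆ b∈U ab≡rot with x∈⁅y⁆⇒x≡y v a∈⁅v⁆ | b ≟ v
    ... | refl | yes refl = x∈⁅x⁆ v
    ... | refl | no  b≢v  =
      contradiction (sym (trans (cong (c v) (sym (only-w b∈U b≢v))) ab≡rot)) (rot≢id (c v w))

  -- With K y the r-component of y in U - v: either some K y receives no r-edge from v and
  -- splits U for r, or all edges leaving some K y from y have one colour s and K y splits U
  -- for the third colour, or else every edge at v has colour r and ⁅ v ⁆ splits U.
  module SplitExtension {U : Subset n} {v : Fin n} (v∈U : v ∈ U) (sep : Split (U - v)) where

    open ≡-Reasoning

    private
      U′ = U - v
      r  = Split.colour sep
      K  = component c-sym r U′

    U′⊆U : U′ ⊆ U
    U′⊆U = p─q⊆p U ⁅ v ⁆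

    v∉U′ : v ∉ U′
    v∉U′ v∈U′ = x∈p─q⇒x∉q v∈U′ (x∈⁅x⁆ v)

    ∈U′ : ∀ {b} → b ∈ U → b ≢ v → b ∈ U′
    ∈U′ = x∈p∧x≢y⇒x∈p-y

    v∉K : ∀ {y} → y ∈ U′ → v ∉ K y
    v∉K y∈U′ = v∉U′ ∘ component⊆ c-sym y∈U′

    no-r-edge-into : ∀ {y z x} → y ∈ U′ → y ∉ K z → x ∈ K z → c y x ≢ r
    no-r-edge-into y∈U′ y∉Kz x∈Kz yx≡r =
      y∉Kz (component-closed c-sym x∈Kz y∈U′ (trans (c-sym _ _) yx≡r))

    no-r-edge-out : ∀ {y z} → z ∈ U′ → z ∉ K y → c y z ≢ r
    no-r-edge-out z∈U′ z∉Ky yz≡r = no-r-edge-into z∈U′ z∉Ky (x∈component c-sym) (trans (c-sym _ _) yz≡r)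

    separated : ∀ {y z} → z ∈ U′ → z ∉ K y → y ∉ K z
    separated z∈U′ z∉Ky y∈Kz = z∉Ky (connected⊆closed c (component-connected c-sym)
      (component⊆ c-sym z∈U′) (component-closed c-sym) y∈Kz (x∈component c-sym) (x∈component c-sym))

    uniform-towards-K : ∀ {y z a b} → y ∈ U′ → y ∉ K z → a ∈ K z → b ∈ K z → c y a ≡ c y b
    uniform-towards-K y∈U′ y∉Kz = uniform-towards-connected gallai (component-connected c-sym) y∉Kz
      (no-r-edge-into y∈U′ y∉Kz)

    outside-K : ∀ {y} → y ∈ U′ → ∃[ z ] (z ∈ U′ × z ∉ K y)
    outside-K y∈U′ = proj₂ (connected⊂ sep (component-connected c-sym) (component⊆ c-sym y∈U′))

    r-edge-from-v : ∀ {z} → z ∈ U′ → Split U ⊎ ∃[ x ] (x ∈ K z × c v x ≡ r)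
    r-edge-from-v {z} z∈U′ with any? (λ x → x ∈? K z ×-dec c v x ≟ r)
    ... | yes found = inj₂ found
    ... | no  none  = inj₁ record
      { colour = r
      ; part   = K z
      ; closed = Kz-closed
      ; inner  = z , U′⊆U z∈U′ , x∈component c-sym
      ; outer  = v , v∈U , v∉K z∈U′
      }
      where
      Kz-closed : Closed c r U (K z)
      Kz-closed {a} {b} a∈Kz b∈U ab≡r with b ≟ v
      ... | yes refl = contradiction (a , a∈Kz , trans (c-sym v a) ab≡r) none
      ... | no  b≢v  = component-closed c-sym a∈Kz (∈U′ b∈U b≢v) ab≡r

    colour-at-v : ∀ {y z x} → y ∈ U′ → z ∈ U′ → z ∉ K y → x ∈ K z → c v x ≡ r →
                  c v y ≡ r ⊎ c v y ≡ c y z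
    colour-at-v {y} {z} {x} y∈U′ z∈U′ z∉Ky x∈Kz vx≡r with c v y ≟ c y z
    ... | yes vy≡yz = inj₂ vy≡yz
    ... | no  vy≢yz = inj₁ (trans (no-rainbow gallai v≢y y≢x v≢x
                              (λ vy≡yx → vy≢yz (trans vy≡yx yx≡yz))
                              (λ yx≡vx → no-r-edge-into y∈U′ y∉Kz x∈Kz (trans yx≡vx vx≡r)))
                            vx≡r)
      where
      y∉Kz : y ∉ K z
      y∉Kz = separated z∈U′ z∉Ky
      yx≡yz : c y x ≡ c y z
      yx≡yz = uniform-towards-K y∈U′ y∉Kz x∈Kz (x∈component c-sym)
      v≢y : v ≢ y
      v≢y refl = v∉U′ y∈U′
      y≢x : y ≢ x
      y≢x refl = y∉Kz x∈Kz
      v≢x : v ≢ x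
      v≢x refl = v∉K z∈U′ x∈Kz

    split-from-uniform-vertex : ∀ {y s s′} → y ∈ U′ → (∀ {z} → z ∈ U′ → z ∉ K y → c y z ≡ s) →
                                s′ ≢ r → s′ ≢ s → Split U
    split-from-uniform-vertex {y} {s} {s′} y∈U′ y-uniform s′≢r s′≢s with outside-K y∈U′
    ... | z , z∈U′ , z∉Ky with r-edge-from-v z∈U′
    ...   | inj₁ U-split = U-split
    ...   | inj₂ (w , w∈Kz , vw≡r) = record
      { colour = s′
      ; part   = K y
      ; closed = Ky-closed
      ; inner  = y , U′⊆U y∈U′ , x∈component c-sym
      ; outer  = v , v∈U , v∉K y∈U′
      }
      where
      Ky-closed : Closed c s′ U (K y)
      Ky-closed {a} {b} a∈Ky b∈U ab≡s′ with b ≟ v | b ∈? K y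
      ... | _        | yes b∈Ky = b∈Ky
      ... | no  b≢v  | no  b∉Ky = contradiction (begin
        s′    ≡⟨ ab≡s′ ⟨
        c a b ≡⟨ c-sym a b ⟩
        c b a ≡⟨ uniform-towards-K b∈U′ b∉Ky a∈Ky (x∈component c-sym) ⟩
        c b y ≡⟨ c-sym b y ⟩
        c y b ≡⟨ y-uniform b∈U′ b∉Ky ⟩
        s     ∎) s′≢s
        where b∈U′ = ∈U′ b∈U b≢v
      ... | yes refl | no  _    with colour-at-v a∈U′ z∈U′ z∉Ka w∈Kz vw≡r
        where
        a∈U′ : a ∈ U′
        a∈U′ = component⊆ c-sym y∈U′ a∈Ky
        z∉Ka : z ∉ K a
        z∉Ka = z∉Ky ∘ connected⊆closed c (component-connected c-sym) (component⊆ c-sym a∈U′)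
                          (component-closed c-sym) (x∈component c-sym) a∈Ky
      ...   | inj₁ va≡r  = contradiction (trans (sym ab≡s′) (trans (c-sym a v) va≡r)) s′≢r
      ...   | inj₂ va≡az = contradiction (begin
        s′    ≡⟨ ab≡s′ ⟨
        c a v ≡⟨ c-sym a v ⟩
        c v a ≡⟨ va≡az ⟩
        c a z ≡⟨ c-sym a z ⟩
        c z a ≡⟨ uniform-towards-K z∈U′ z∉Ky a∈Ky (x∈component c-sym) ⟩
        c z y ≡⟨ c-sym z y ⟩
        c y z ≡⟨ y-uniform z∈U′ z∉Ky ⟩
        s     ∎) s′≢s

    exit? : ∀ y s → Dec (∃[ z ] (z ∈ U′ × z ∉ K y × c y z ≢ s))
    exit? y s = any? λ z → z ∈? U′ ×-dec ¬? (z ∈? K y) ×-dec ¬? (c y z ≟ s)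

    no-exit⇒uniform : ∀ {y s} → ¬ (∃[ z ] (z ∈ U′ × z ∉ K y × c y z ≢ s)) →
                      ∀ {z} → z ∈ U′ → z ∉ K y → c y z ≡ s
    no-exit⇒uniform no-exit z∈U′ z∉Ky =
      decidable-stable (_ ≟ _) λ yz≢s → no-exit (_ , z∈U′ , z∉Ky , yz≢s)

    -- Edges of both colours other than r leave K y from y; apply colour-at-v to each.
    r-edge-at-v : ∀ {y} → y ∈ U′ → Split U ⊎ c v y ≡ r
    r-edge-at-v {y} y∈U′ with exit? y (rot r) | exit? y (rot (rot r))
    ... | no no-exit | _ = inj₁ (split-from-uniform-vertex y∈U′ (no-exit⇒uniform no-exit)
                                  (rot²≢id r) (rot≢rot² r ∘ sym))
    ... | yes _ | no no-exit = inj₁ (split-from-uniform-vertex y∈U′ (no-exit⇒uniform no-exit)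
                                      (rot≢id r) (rot≢rot² r))
    ... | yes (z₁ , z₁∈U′ , z₁∉Ky , yz₁≢p) | yes (z₂ , z₂∈U′ , z₂∉Ky , yz₂≢q)
      with r-edge-from-v z₁∈U′ | r-edge-from-v z₂∈U′
    ...   | inj₁ U-split | _            = inj₁ U-split
    ...   | inj₂ _       | inj₁ U-split = inj₁ U-split
    ...   | inj₂ (w₁ , w₁∈Kz₁ , vw₁≡r) | inj₂ (w₂ , w₂∈Kz₂ , vw₂≡r)
      with colour-at-v y∈U′ z₁∈U′ z₁∉Ky w₁∈Kz₁ vw₁≡r | colour-at-v y∈U′ z₂∈U′ z₂∉Ky w₂∈Kz₂ vw₂≡r
    ...     | inj₁ vy≡r    | _            = inj₂ vy≡r
    ...     | inj₂ _       | inj₁ vy≡r    = inj₂ vy≡r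
    ...     | inj₂ vy≡yz₁  | inj₂ vy≡yz₂  = contradiction
      (trans (sym yz₂≡p) (trans (sym vy≡yz₂) (trans vy≡yz₁ yz₁≡q))) (rot≢rot² r)
      where
      yz₁≡q : c y z₁ ≡ rot (rot r)
      yz₁≡q = third-colour₂ (no-r-edge-out z₁∈U′ z₁∉Ky) yz₁≢p
      yz₂≡p : c y z₂ ≡ rot r
      yz₂≡p = third-colour₁ (no-r-edge-out z₂∈U′ z₂∉Ky) yz₂≢q

    split : Split U
    split with any? (λ y → y ∈? U′ ×-dec ¬? (c v y ≟ r))
    ... | yes (y , y∈U′ , vy≢r) with r-edge-at-v y∈U′
    ...   | inj₁ U-split = U-split
    ...   | inj₂ vy≡r    = contradiction vy≡r vy≢r
    split | no all-r = record
      { colour = rot r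
      ; part   = ⁅ v ⁆
      ; closed = v-closed
      ; inner  = v , v∈U , x∈⁅x⁆ v
      ; outer  = y , U′⊆U y∈U′ , λ y∈⁅v⁆ → v∉U′ (subst (_∈ U′) (x∈⁅y⁆⇒x≡y v y∈⁅v⁆) y∈U′)
      }
      where
      y = proj₁ (Split.outer sep)
      y∈U′ = proj₁ (proj₂ (Split.outer sep))
      v-closed : Closed c (rot r) U ⁅ v ⁆
      v-closed {a} {b} a∈⁅v⁆ b∈U ab≡rot with x∈⁅y⁆⇒x≡y v a∈⁅v⁆ | b ≟ v
      ... | refl | yes refl = x∈⁅x⁆ v
      ... | refl | no  b≢v  = contradiction
        (b , ∈U′ b∈U b≢v , λ vb≡r → rot≢id r (trans (sym ab≡rot) vb≡r)) all-r

  gallai-split : ∀ U → Acc _⊂_ U → 2 ≤ ∣ U ∣ → Split U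
  gallai-split U (acc rec) 2≤∣U∣ with 0<∣p∣⇒nonempty (≤-trans (s≤s z≤n) 2≤∣U∣)
  ... | v , v∈U with 2 ≤? ∣ U - v ∣
  ...   | yes 2≤∣U-v∣ =
          SplitExtension.split v∈U (gallai-split (U - v) (rec (x∈p⇒p-x⊂p v∈U)) 2≤∣U-v∣)
  ...   | no  2≰∣U-v∣ with 0<∣p∣⇒nonempty (s≤s⁻¹ (subst (2 ≤_) (∣p∣≡1+∣p-x∣ v∈U) 2≤∣U∣))
  ...     | w , w∈U-v =
            split-pair v∈U (p─q⊆p U ⁅ v ⁆ w∈U-v) (λ { refl → x∈p─q⇒x∉q w∈U-v (x∈⁅x⁆ v) }) only-w
    where
    only-w : ∀ {b} → b ∈ U → b ≢ v → b ≡ w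
    only-w {b} b∈U b≢v = decidable-stable (b ≟ w) λ b≢w →
      2≰∣U-v∣ (two-elements⇒2≤∣p∣ (x∈p∧x≢y⇒x∈p-y b∈U b≢v) w∈U-v b≢w)

-- Counting colour classes

module Counting {n} {c : EdgeColouring n 3} (c-sym : Symmetric c) (gallai : Gallai c)
  (k : Fin 3 → ℕ) (f : (i : Fin 3) → Fin n → Fin (k i))
  (f-clique : ∀ i {x y} → x ≢ y → f i x ≡ f i y → c x y ≡ i) where

  classes : Fin 3 → Subset n → ℕ
  classes i U = ∣ image (f i) U ∣

  Bound : Subset n → Set
  Bound U = ∣ U ∣ * ∣ U ∣ ≤ classes (# 0) U * classes (# 1) U * classes (# 2) U

  classes-split : ∀ {r W C} → C ⊆ W → Closed c r W C → classes r C + classes r (W ─ C) ≤ classes r W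
  classes-split {r} {W} {C} C⊆W C-closed =
    disjoint⇒∣p∣+∣q∣≤∣s∣ (image-mono C⊆W) (image-mono (p─q⊆p W C)) disjoint
    where
    disjoint : ∀ {α} → α ∈ image (f r) C → α ∉ image (f r) (W ─ C)
    disjoint α∈fC α∈fD with ∈-image⁻ α∈fC | ∈-image⁻ α∈fD
    ... | x , x∈C , fx≡α | y , y∈D , fy≡α =
      x∈p─q⇒x∉q y∈D (C-closed x∈C (p─q⊆p W C y∈D) (f-clique r x≢y (trans fx≡α (sym fy≡α))))
      where
      x≢y : x ≢ y
      x≢y refl = x∈p─q⇒x∉q y∈D x∈C

  rectangle : ∀ r → Subset n → Subset₂ (k (rot r)) (k (rot (rot r)))
  rectangle r U = image (f (rot r)) U ⊠ image (f (rot (rot r))) U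

  ∣rectangle∣₂ : ∀ r U → ∣ rectangle r U ∣₂ ≡ classes (rot r) U * classes (rot (rot r)) U
  ∣rectangle∣₂ r U = ∣⊠∣₂ (image (f (rot r)) U) (image (f (rot (rot r))) U)

  ∈-rectangle⁺ : ∀ {r U x y} → x ∈ U → y ∈ U → f (rot (rot r)) y ∈ rectangle r U (f (rot r) x)
  ∈-rectangle⁺ {r} x∈U y∈U = ∈-⊠⁺ (∈-image⁺ {g = f (rot r)} x∈U) (∈-image⁺ {g = f (rot (rot r))} y∈U)

  ∈-rectangle⁻ : ∀ {r U α β} → β ∈ rectangle r U α →
                 (∃[ x ] (x ∈ U × f (rot r) x ≡ α)) × (∃[ y ] (y ∈ U × f (rot (rot r)) y ≡ β))
  ∈-rectangle⁻ {r} {U} β∈ with ∈-⊠⁻ {A = image (f (rot r)) U} β∈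
  ... | α∈ , β∈′ = ∈-image⁻ {g = f (rot r)} α∈ , ∈-image⁻ {g = f (rot (rot r))} β∈′

  Realised : ∀ r → Subset n → Fin (k (rot r)) → Fin (k (rot (rot r))) → Set₁
  Realised r W α β = ∃[ K ] (Connected c r K × K ⊆ W ×
    (∃[ x ] (x ∈ K × f (rot r) x ≡ α)) × (∃[ y ] (y ∈ K × f (rot (rot r)) y ≡ β)))

  record PairBound (r : Fin 3) (W : Subset n) : Set₁ where
    field
      pairs    : Subset₂ (k (rot r)) (k (rot (rot r)))
      bounded  : ∣ W ∣ * ∣ W ∣ ≤ ∣ pairs ∣₂ * classes r W
      realised : ∀ {α β} → β ∈ pairs α → Realised r W α β

  -- Otherwise the edge x′y between the realisations in C and in K has colour c x′ x = rot r
  -- and colour c y y′ = rot (rot r).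
  rectangle-disjoint : ∀ {r W C α β} → Connected c r C → Closed c r W C →
                       β ∈ rectangle r C α → ¬ Realised r (W ─ C) α β
  rectangle-disjoint {r} {W} {C} C-conn C-closed β∈R
                     (K , K-conn , K⊆D , (x , x∈K , fx≡α) , (y , y∈K , fy≡β))
    with ∈-rectangle⁻ {r} β∈R
  ... | (x′ , x′∈C , fx′≡α) , (y′ , y′∈C , fy′≡β) = rot≢rot² r (begin
    rot r       ≡⟨ f-clique (rot r) x′≢x (trans fx′≡α (sym fx≡α)) ⟨
    c x′ x      ≡⟨ uniform-towards-connected gallai K-conn x′∉K no-r-edge-to-K x∈K y∈K ⟩
    c x′ y      ≡⟨ c-sym x′ y ⟩
    c y x′      ≡⟨ uniform-towards-connected gallai C-conn y∉C no-r-edge-to-C x′∈C y′∈C ⟩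
    c y y′      ≡⟨ f-clique (rot (rot r)) y≢y′ (trans fy≡β (sym fy′≡β)) ⟩
    rot (rot r) ∎)
    where
    open ≡-Reasoning
    ∉C : ∀ {z} → z ∈ K → z ∉ C
    ∉C z∈K = x∈p─q⇒x∉q (K⊆D z∈K)
    ∈W : ∀ {z} → z ∈ K → z ∈ W
    ∈W z∈K = p─q⊆p W C (K⊆D z∈K)
    y∉C : y ∉ C
    y∉C = ∉C y∈K
    x′∉K : x′ ∉ K
    x′∉K x′∈K = ∉C x′∈K x′∈C
    x′≢x : x′ ≢ x
    x′≢x refl = ∉C x∈K x′∈C
    y≢y′ : y ≢ y′
    y≢y′ refl = y∉C y′∈C
    no-r-edge-to-K : ∀ {z} → z ∈ K → c x′ z ≢ r
    no-r-edge-to-K z∈K x′z≡r = ∉C z∈K (C-closed x′∈C (∈W z∈K) x′z≡r)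
    no-r-edge-to-C : ∀ {z} → z ∈ C → c y z ≢ r
    no-r-edge-to-C z∈C yz≡r = y∉C (C-closed z∈C (∈W y∈K) (trans (c-sym _ _) yz≡r))

  extend : ∀ {r W C} → C ⊆ W → Connected c r C → Closed c r W C → Bound C →
           PairBound r (W ─ C) → PairBound r W
  extend {r} {W} {C} C⊆W C-conn C-closed C-bound D-bound = record
    { pairs    = rectangle r C ∪₂ pairs
    ; bounded  = W-bounded
    ; realised = W-realised
    }
    where
    open PairBound D-bound
    D = W ─ C
    C-bounded : ∣ C ∣ * ∣ C ∣ ≤ ∣ rectangle r C ∣₂ * classes r C
    C-bounded = subst (∣ C ∣ * ∣ C ∣ ≤_) (sym (trans (cong (_* classes r C) (∣rectangle∣₂ r C))
                                                    (rotate-product (λ i → classes i C) r)))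
                      C-bound
    W-bounded : ∣ W ∣ * ∣ W ∣ ≤ ∣ rectangle r C ∪₂ pairs ∣₂ * classes r W
    W-bounded = begin
      ∣ W ∣ * ∣ W ∣                                                   ≡⟨ cong (λ m → m * m) ∣W∣≡∣C∣+∣D∣ ⟩
      (∣ C ∣ + ∣ D ∣) * (∣ C ∣ + ∣ D ∣)                               ≤⟨ C∪D-bounded ⟩
      (∣ rectangle r C ∣₂ + ∣ pairs ∣₂) * (classes r C + classes r D)
        ≤⟨ *-mono-≤ pairs-split (classes-split C⊆W C-closed) ⟩
      ∣ rectangle r C ∪₂ pairs ∣₂ * classes r W                        ∎
      where
      open ≤-Reasoning
      ∣W∣≡∣C∣+∣D∣ = ∣p∣≡∣q∣+∣p─q∣ W C C⊆W
      C∪D-bounded = cauchy-schwarz₂ {∣ C ∣} {∣ D ∣} {∣ rectangle r C ∣₂} {∣ pairs ∣₂}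
                                    {classes r C} {classes r D} C-bounded bounded
      pairs-split = ∣∪₂∣-disjoint {P = rectangle r C} {Q = pairs}
                      λ β∈R β∈P → rectangle-disjoint C-conn C-closed β∈R (realised β∈P)
    W-realised : ∀ {α β} → β ∈ (rectangle r C ∪₂ pairs) α → Realised r W α β
    W-realised β∈ with x∈p∪q⁻ _ _ β∈
    ... | inj₁ β∈R = C , C-conn , C⊆W , ∈-rectangle⁻ {r} β∈R
    ... | inj₂ β∈P with realised β∈P
    ...   | K , K-conn , K⊆D , in-K = K , K-conn , (λ z∈K → p─q⊆p W C (K⊆D z∈K)) , in-K

  empty-pairBound : ∀ {r W} → Empty W → PairBound r W
  empty-pairBound W-empty = record
    { pairs    = λ _ → ⊥
    ; bounded  = ≤-trans (≤-reflexive (cong (λ m → m * m) (empty⇒∣p∣≡0 W-empty))) z≤n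
    ; realised = λ β∈⊥ → contradiction β∈⊥ ∉⊥
    }

  pairBound : ∀ r W → Acc _⊂_ W → (∀ {V} → V ⊆ W → Connected c r V → Bound V) → PairBound r W
  pairBound r W (acc rec) bound-below with nonempty? W
  ... | no  W-empty     = empty-pairBound W-empty
  ... | yes (x , x∈W) = extend C⊆W C-conn (component-closed c-sym) (bound-below C⊆W C-conn)
    (pairBound r (W ─ C) (rec D⊂W) λ V⊆D → bound-below λ z∈V → p─q⊆p W C (V⊆D z∈V))
    where
    C = component c-sym r W x
    C⊆W : C ⊆ W
    C⊆W = component⊆ c-sym x∈W
    C-conn : Connected c r C
    C-conn = component-connected c-sym
    D⊂W : W ─ C ⊂ W
    D⊂W = p─q⊆p W C , x , x∈W , λ x∈D → x∈p─q⇒x∉q x∈D (x∈component c-sym)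

  pairBound⇒Bound : ∀ {r U} → PairBound r U → Bound U
  pairBound⇒Bound {r} {U} U-bound = begin
    ∣ U ∣ * ∣ U ∣                                             ≤⟨ bounded ⟩
    ∣ pairs ∣₂ * classes r U                                   ≤⟨ *-monoˡ-≤ _ (∣∣₂-mono pairs⊆rectangle) ⟩
    ∣ rectangle r U ∣₂ * classes r U                           ≡⟨ cong (_* classes r U) (∣rectangle∣₂ r U) ⟩
    classes (rot r) U * classes (rot (rot r)) U * classes r U ≡⟨ rotate-product (λ i → classes i U) r ⟩
    classes (# 0) U * classes (# 1) U * classes (# 2) U       ∎
    where
    open ≤-Reasoning
    open PairBound U-bound
    pairs⊆rectangle : pairs ⊆₂ rectangle r U
    pairs⊆rectangle α β∈ with realised β∈
    ... | K , _ , K⊆U , (x , x∈K , refl) , (y , y∈K , refl) = ∈-rectangle⁺ {r} (K⊆U x∈K) (K⊆U y∈K)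

  ≤1⇒Bound : ∀ {U} → ∣ U ∣ ≤ 1 → Bound U
  ≤1⇒Bound {U} ∣U∣≤1 with nonempty? U
  ... | no  U-empty rewrite empty⇒∣p∣≡0 U-empty = z≤n
  ... | yes (x , x∈U) rewrite ≤-antisym ∣U∣≤1 (x∈p⇒0<∣p∣ x∈U) =
    *-mono-≤ (*-mono-≤ (meets (# 0)) (meets (# 1))) (meets (# 2))
    where
    meets : ∀ i → 1 ≤ classes i U
    meets i = x∈p⇒0<∣p∣ (∈-image⁺ {g = f i} x∈U)

  bound : ∀ U → Acc _⊂_ U → Bound U
  bound U (acc rec) with 2 ≤? ∣ U ∣
  ... | no  2≰∣U∣ = ≤1⇒Bound (s≤s⁻¹ (≰⇒> 2≰∣U∣))
  ... | yes 2≤∣U∣ = pairBound⇒Bound (pairBound (Split.colour sep) U (⊂-wellFounded U)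
    λ {V} V⊆U V-conn → bound V (rec (connected⊂ c-sym gallai sep V-conn V⊆U)))
    where
    sep = gallai-split c-sym gallai U (acc rec) 2≤∣U∣

  product-bound : n * n ≤ k (# 0) * k (# 1) * k (# 2)
  product-bound = subst (λ m → m * m ≤ _) (∣⊤∣≡n n)
    (≤-trans (bound ⊤ (⊂-wellFounded ⊤))
             (*-mono-≤ (*-mono-≤ (classes≤k (# 0)) (classes≤k (# 1))) (classes≤k (# 2))))
    where
    classes≤k : ∀ i → classes i ⊤ ≤ k i
    classes≤k i = ∣p∣≤n (image (f i) ⊤)

∃-function? : ∀ m {k} (P : (Fin m → Fin k) → Set) → (∀ {g h} → g ≗ h → P g → P h) →
              (∀ g → Dec (P g)) → Dec (∃ P)
∃-function? zero    P P-resp P? with P? (λ ())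
... | yes Pg = yes (_ , Pg)
... | no ¬Pg = no λ (g , Pg) → ¬Pg (P-resp (λ ()) Pg)
∃-function? (suc m) P P-resp P?
  with any? (λ a → ∃-function? m (P ∘ (a Vector.∷_)) (λ g≗h → P-resp λ { zero → refl ; (suc i) → g≗h i })
                                 (P? ∘ (a Vector.∷_)))
... | yes (a , g , Pag) = yes (a Vector.∷ g , Pag)
... | no ¬∃ = no λ (g , Pg) → ¬∃ (head g , tail g , P-resp (λ { zero → refl ; (suc i) → refl }) Pg)

module _ {n} (c : EdgeColouring n 3) where

  colourable? : ∀ S k → Dec (Colourable c S k)
  colourable? S k = ∃-function? n (ProperColouring c S k) respects proper?
    where
    respects : ∀ {g h} → g ≗ h → ProperColouring c S k g → ProperColouring c S k h
    respects g≗h g-proper i j adj hi≡hj = g-proper i j adj (trans (g≗h i) (trans hi≡hj (sym (g≗h j))))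
    proper? : ∀ g → Dec (ProperColouring c S k g)
    proper? g = all? λ i → all? λ j → (¬? (i ≟ j) ×-dec c i j ∈? S) →-dec ¬? (g i ≟ g j)

  class-monochromatic : ∀ {i k g x y} → ProperColouring c (∁ ⁅ i ⁆) k g → x ≢ y → g x ≡ g y → c x y ≡ i
  class-monochromatic {i} {x = x} {y} g-proper x≢y gx≡gy = decidable-stable (c x y ≟ i) λ xy≢i →
    g-proper x y (x≢y , x∉p⇒x∈∁p (x≢y⇒x∉⁅y⁆ xy≢i)) gx≡gy

  SmallColouring : Fin 3 → Set
  SmallColouring i = ∃[ k ] (k < n × k ^ 3 < n ^ 2 × Colourable c (∁ ⁅ i ⁆) k)

  smallColouring? : ∀ i → Dec (SmallColouring i)
  smallColouring? i = anyUpTo? (λ k → k ^ 3 <? n ^ 2 ×-dec colourable? (∁ ⁅ i ⁆) k) n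

  omit-colour : 1 ≤ n → ∀ i → ¬ SmallColouring i → ∃[ S ] (∣ S ∣ ≤ 2 × ChromaticCubeAtLeast c S (n ^ 2))
  omit-colour 1≤n i ¬small = ∁ ⁅ i ⁆ , ∣∁⁅i⁆∣≤2 , cube-bound
    where
    ∣∁⁅i⁆∣≤2 : ∣ ∁ ⁅ i ⁆ ∣ ≤ 2
    ∣∁⁅i⁆∣≤2 = ≤-reflexive (trans (∣∁p∣≡n∸∣p∣ ⁅ i ⁆) (cong (3 ∸_) (∣⁅x⁆∣≡1 i)))
    cube-bound : ChromaticCubeAtLeast c (∁ ⁅ i ⁆) (n ^ 2)
    cube-bound k k-colourable with n ≤? k | n ^ 2 ≤? k ^ 3
    ... | _       | yes n²≤k³ = n²≤k³
    ... | yes n≤k | no  _     = square≤cube 1≤n n≤k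
    ... | no  n≰k | no  n²≰k³ = contradiction (k , ≰⇒> n≰k , ≰⇒> n²≰k³ , k-colourable) ¬small

module _ {n} {c : EdgeColouring n 3} (c-sym : Symmetric c) (gallai : Gallai c) where

  no-three-small-colourings : ¬ (∀ i → SmallColouring c i)
  no-three-small-colourings small =
    <⇒≱ (small-cubes⇒product< {k (# 0)} {k (# 1)} {k (# 2)} (cube< (# 0)) (cube< (# 1)) (cube< (# 2)))
        n²≤product
    where
    k : Fin 3 → ℕ
    k i = proj₁ (small i)
    cube< : ∀ i → k i ^ 3 < n ^ 2
    cube< i = proj₁ (proj₂ (proj₂ (small i)))
    f : (i : Fin 3) → Fin n → Fin (k i)
    f i = proj₁ (proj₂ (proj₂ (proj₂ (small i))))
    f-clique : ∀ i {x y} → x ≢ y → f i x ≡ f i y → c x y ≡ i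
    f-clique i = class-monochromatic c (proj₂ (proj₂ (proj₂ (proj₂ (small i)))))
    n²≤product : n ^ 2 ≤ k (# 0) * k (# 1) * k (# 2)
    n²≤product = ≤-trans (≤-reflexive (cong (n *_) (*-identityʳ n)))
                   (Counting.product-bound c-sym gallai k f f-clique)

theorem1p2 : (n : ℕ) → 1 ≤ n → (c : EdgeColouring n 3) → Symmetric c → Gallai c →
    ∃[ S ] (∣ S ∣ ≤ 2 × ChromaticCubeAtLeast c S (n ^ 2))
theorem1p2 n 1≤n c c-sym gallai
  with smallColouring? c (# 0) | smallColouring? c (# 1) | smallColouring? c (# 2)
... | no ¬small | _         | _         = omit-colour c 1≤n (# 0) ¬small
... | yes _     | no ¬small | _         = omit-colour c 1≤n (# 1) ¬small
... | yes _     | yes _     | no ¬small = omit-colour c 1≤n (# 2) ¬small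
... | yes s₀    | yes s₁    | yes s₂    = contradiction
  (λ { zero → s₀ ; (suc zero) → s₁ ; (suc (suc zero)) → s₂ }) (no-three-small-colourings c-sym gallai)
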